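{- Let $k\in\mathbb{Z}^+$, $n\ge 2k+1$, and let $i,j\in[n]$ be distinct. The number of permutations $\pi\in\mathcal{S}_n$ satisfying $\pi^k(i)=j$ and $\pi^k(j)=i$ is $\tau_{\mathrm{o}}(k)\,(n-2)!$.
   Context: $\mathcal{S}_n$ is the symmetric group on $[n]=\{1,\dots,n\}$. $\tau_{\mathrm{o}}(k)$ is the number of odd positive divisors of $k$, i.e. $\tau(k/2^{\nu_2(k)})$ where $\tau$ counts positive divisors and $\nu_2(k)$ is the exponent of $2$ in $k$. -}

module Defs where

open import Data.Nat using (ℕ; zero; suc; _%_)
open import Data.Nat.Divisibility using (_∣_; _∣?_)
open import Data.Fin using (Fin; _≟_)
open import Data.Vec using (Vec; []; _∷_; lookup; toList)
open import Data.List using (List; []; _∷_; map; concatMap; allFin; length; filter; upTo)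
open import Data.List.Relation.Unary.Unique.Propositional using (Unique)
import Data.List.Relation.Unary.Unique.DecPropositional as UDec
open import Data.Product using (_×_)
open import Relation.Nullary using (Dec)
open import Relation.Nullary.Decidable using (_×-dec_)
open import Relation.Binary.PropositionalEquality using (_≡_)
open import Function using (_∘_)

allVecs : (n m : ℕ) → List (Vec (Fin m) n)
allVecs zero    m = [] ∷ []
allVecs (suc n) m = concatMap (λ x → map (x ∷_) (allVecs n m)) (allFin m)

-- A vector v : Vec (Fin n) n encodes the map i ↦ lookup v i on [n];
-- it is a permutation iff its entries are pairwise distinct.
IsPerm : ∀ {n} → Vec (Fin n) n → Set
IsPerm v = Unique (toList v)

isPerm? : ∀ {n} (v : Vec (Fin n) n) → Dec (IsPerm v)
isPerm? {n} v = UDec.unique? (_≟_ {n}) (toList v)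

Sym : (n : ℕ) → List (Vec (Fin n) n)
Sym n = filter isPerm? (allVecs n n)

iter : ∀ {n} → Vec (Fin n) n → ℕ → Fin n → Fin n
iter π zero    i = i
iter π (suc k) i = lookup π (iter π k i)

countSwap : (n k : ℕ) → Fin n → Fin n → ℕ
countSwap n k i j =
  length (filter (λ π → (iter π k i ≟ j) ×-dec (iter π k j ≟ i)) (Sym n))

OddDivisor : ℕ → ℕ → Set
OddDivisor k d = (d ∣ k) × (d % 2 ≡ 1)

oddDivisor? : ∀ k d → Dec (OddDivisor k d)
oddDivisor? k d = (d ∣? k) ×-dec (d % 2 Data.Nat.≟ 1)

τₒ : ℕ → ℕ
τₒ k = length (filter (oddDivisor? k) (map suc (upTo k)))

{-# OPTIONS --safe #-}
module Submission where

-- Let R be the length of the cycle of i under π. If π^k swaps i and j ≠ i, then ρ = k mod R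
-- satisfies π^ρ i = j and R ∣ k + ρ, hence R ∣ 2ρ; as 0 < 2ρ < 2R this forces R = 2ρ, so k = ρ d
-- with d odd. Conversely such a π swaps i and j. Hence the permutations counted split, according
-- to the odd divisor d of k, into the classes "i lies on a cycle of length 2t and π^t i = j",
-- t = k / d.
--
-- Each class has (n-2)! elements: for 1 ≤ t < L ≤ n, the number N_n(L,t) of π ∈ S_n with i on an
-- L-cycle and π^t i = j is (n-2)!. By induction on n: every π ∈ S_{n+1} arises exactly once by
-- inserting a new point x just before some c ∈ [n+1] into some σ ∈ S_n (c = x: as a fixed point).
-- Following where x lands relative to the cycle of i gives
--   N_{n+1}(L,t) = (n+1-L) N_n(L,t) + (L-1-t) N_n(L-1,t) + (t-1) N_n(L-1,t-1),
-- and the coefficients sum to n-1.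

open import Defs
open import Level using (Level)
open import Function using (id; _∘_)
open import Function.Bundles using (mk⇔)
open import Data.Empty using (⊥-elim)
open import Data.Product using (_×_; _,_; proj₁; proj₂; ∃)
open import Data.Sum using (_⊎_; inj₁; inj₂)
open import Relation.Binary.PropositionalEquality
open import Relation.Binary.Definitions using (DecidableEquality; Tri; tri<; tri≈; tri>)
open import Relation.Nullary using (Dec; yes; no; ¬_)
open import Relation.Nullary.Decidable using (decidable-stable; _×-dec_; _→-dec_; ¬?)
open import Relation.Unary using (Pred; Decidable)

open import Data.Nat
  using (ℕ; zero; suc; _+_; _*_; _∸_; _⊓_; _≤_; _<_; _≥_; z≤n; s≤s; _≤?_; _<?_; _!; NonZero; >-nonZero)
import Data.Nat as ℕ
open import Data.Nat.Properties hiding (_≟_)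
open import Algebra.Properties.CommutativeSemigroup +-commutativeSemigroup using (interchange)
open import Data.Nat.DivMod using (_%_; _/_; m≡m%n+[m/n]*n; m%n<n; [m+kn]%n≡m%n; m/n*n≡m; m*n/n≡m; m/n≤m)
open import Data.Nat.Divisibility using (_∣_; divides; m%n≡0⇒n∣m; ∣m+n∣m⇒∣n; n∣m*n; ∣⇒≤)
open import Data.Nat.ListAction using (sum)
open import Data.Nat.ListAction.Properties using (sum-++; sum-↭)
open import Data.Nat.Tactic.RingSolver using (solve-∀)

open import Data.List
  using (List; []; _∷_; _++_; map; filter; length; concatMap; cartesianProductWith; allFin; upTo; downFrom; applyDownFrom)
open import Data.List.Properties using (map-++; map-∘; length-++; length-tabulate; length-applyDownFrom; map-downFrom)
open import Data.List.Membership.Propositional using (_∈_; _∉_)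
open import Data.List.Membership.Propositional.Properties
open import Data.List.Membership.Propositional.Properties.WithK using (unique∧set⇒bag)
open import Data.List.Relation.Unary.Any using (here; there)
open import Data.List.Relation.Unary.All using ([]; _∷_)
import Data.List.Relation.Unary.All as All
open import Data.List.Relation.Unary.Unique.Propositional using (Unique; []; _∷_)
import Data.List.Relation.Unary.Unique.Propositional.Properties as Unique
open import Data.List.Relation.Binary.Permutation.Propositional using (_↭_)
import Data.List.Relation.Binary.Permutation.Propositional.Properties as ↭
open import Data.List.Relation.Binary.BagAndSetEquality using (∼bag⇒↭)

open import Data.Fin using (Fin; zero; suc; _≟_; punchIn; punchOut; toℕ)
open import Data.Fin.Properties
  using (pigeonhole; punchInᵢ≢i; punchIn-injective; punchOut-injective; punchOut-cong; punchOut-punchIn; punchIn-punchOut)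
open import Data.Fin.Permutation.Components using (transpose; transpose-inverse)
open import Data.Vec using (Vec; []; _∷_; lookup; toList; tabulate)
open import Data.Vec.Properties using (∷-injective; lookup∘tabulate; tabulate∘lookup; tabulate-cong)
import Data.Vec.Relation.Unary.All.Properties as VecAll
open import Data.Vec.Relation.Unary.AllPairs using ([]; _∷_)
import Data.Vec.Relation.Unary.Unique.Propositional as Vec
import Data.Vec.Relation.Unary.Unique.Propositional.Properties as VecUnique

private variable
  ℓ ℓ′ : Level
  A B C : Set ℓ

∑ : List A → (A → ℕ) → ℕ
∑ xs f = sum (map f xs)

syntax ∑ xs (λ x → e) = ∑[ x ∈ xs ] e

𝟙 : {P : Set ℓ} → Dec P → ℕ
𝟙 (yes _) = 1
𝟙 (no _)  = 0

𝟙-yes : {P : Set ℓ} (P? : Dec P) → P → 𝟙 P? ≡ 1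
𝟙-yes (yes _) _  = refl
𝟙-yes (no ¬p) p = ⊥-elim (¬p p)

𝟙-no : {P : Set ℓ} (P? : Dec P) → ¬ P → 𝟙 P? ≡ 0
𝟙-no (yes p) ¬p = ⊥-elim (¬p p)
𝟙-no (no _)  _  = refl

𝟙-cong : {P : Set ℓ} {Q : Set ℓ′} (P? : Dec P) (Q? : Dec Q) → (P → Q) → (Q → P) → 𝟙 P? ≡ 𝟙 Q?
𝟙-cong P? (yes q) _   Q⇒P = 𝟙-yes P? (Q⇒P q)
𝟙-cong P? (no ¬q) P⇒Q _   = 𝟙-no P? (¬q ∘ P⇒Q)

length-filter≡∑𝟙 : {P : Pred A ℓ} (P? : Decidable P) (xs : List A) →
                   length (filter P? xs) ≡ ∑[ x ∈ xs ] 𝟙 (P? x)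
length-filter≡∑𝟙 P? []       = refl
length-filter≡∑𝟙 P? (x ∷ xs) with P? x
... | yes _ = cong suc (length-filter≡∑𝟙 P? xs)
... | no  _ = length-filter≡∑𝟙 P? xs

∑-++ : (xs ys : List A) (f : A → ℕ) → ∑ (xs ++ ys) f ≡ ∑ xs f + ∑ ys f
∑-++ xs ys f = trans (cong sum (map-++ f xs ys)) (sum-++ (map f xs) (map f ys))

∑-map : (g : A → B) (xs : List A) (f : B → ℕ) → ∑ (map g xs) f ≡ ∑[ x ∈ xs ] f (g x)
∑-map g xs f = cong sum (sym (map-∘ xs))

∑-↭ : {xs ys : List A} → xs ↭ ys → (f : A → ℕ) → ∑ xs f ≡ ∑ ys f
∑-↭ xs↭ys f = sum-↭ (↭.map⁺ f xs↭ys)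

∑-cong : (xs : List A) {f g : A → ℕ} → (∀ {x} → x ∈ xs → f x ≡ g x) → ∑ xs f ≡ ∑ xs g
∑-cong []       f≡g = refl
∑-cong (x ∷ xs) f≡g = cong₂ _+_ (f≡g (here refl)) (∑-cong xs (f≡g ∘ there))

∑-+ : (xs : List A) (f g : A → ℕ) → ∑[ x ∈ xs ] (f x + g x) ≡ ∑ xs f + ∑ xs g
∑-+ []       f g = refl
∑-+ (x ∷ xs) f g =
  trans (cong ((f x + g x) +_) (∑-+ xs f g)) (interchange (f x) (g x) (∑ xs f) (∑ xs g))

∑-*ʳ : (xs : List A) (f : A → ℕ) (c : ℕ) → ∑[ x ∈ xs ] (f x * c) ≡ ∑ xs f * c
∑-*ʳ []       f c = refl
∑-*ʳ (x ∷ xs) f c = trans (cong (f x * c +_) (∑-*ʳ xs f c)) (sym (*-distribʳ-+ c (f x) (∑ xs f)))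

∑-*ˡ : (xs : List A) (c : ℕ) (f : A → ℕ) → ∑[ x ∈ xs ] (c * f x) ≡ c * ∑ xs f
∑-*ˡ []       c f = sym (*-zeroʳ c)
∑-*ˡ (x ∷ xs) c f = trans (cong (c * f x +_) (∑-*ˡ xs c f)) (sym (*-distribˡ-+ c (f x) (∑ xs f)))

∑-const : (xs : List A) (c : ℕ) → ∑[ x ∈ xs ] c ≡ length xs * c
∑-const []       c = refl
∑-const (x ∷ xs) c = cong (c +_) (∑-const xs c)

∑-zero : (xs : List A) {f : A → ℕ} → (∀ {x} → x ∈ xs → f x ≡ 0) → ∑ xs f ≡ 0
∑-zero xs f≡0 = trans (∑-cong xs f≡0) (trans (∑-const xs 0) (*-zeroʳ (length xs)))

∑-comm : (xs : List A) (ys : List B) (f : A → B → ℕ) →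
         ∑[ x ∈ xs ] ∑[ y ∈ ys ] f x y ≡ ∑[ y ∈ ys ] ∑[ x ∈ xs ] f x y
∑-comm []       ys f = sym (∑-zero ys λ _ → refl)
∑-comm (x ∷ xs) ys f = trans (cong (∑ ys (f x) +_) (∑-comm xs ys f)) (sym (∑-+ ys (f x) _))

∑-𝟙-unique : {P : Pred A ℓ} (P? : Decidable P) {xs : List A} → Unique xs →
             ∀ {x} → x ∈ xs → P x → (∀ {y} → y ∈ xs → P y → y ≡ x) → ∑[ y ∈ xs ] 𝟙 (P? y) ≡ 1
∑-𝟙-unique P? {y ∷ ys} (y∉ys ∷ ys!) (here refl) Py P⇒≡ =
  cong₂ _+_ (𝟙-yes (P? y) Py)
            (∑-zero ys λ z∈ → 𝟙-no (P? _) λ Pz → All.lookup y∉ys z∈ (sym (P⇒≡ (there z∈) Pz)))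
∑-𝟙-unique P? {y ∷ ys} (y∉ys ∷ ys!) (there x∈) Px P⇒≡ =
  cong₂ _+_ (𝟙-no (P? y) λ Py → All.lookup y∉ys x∈ (P⇒≡ (here refl) Py))
            (∑-𝟙-unique P? ys! x∈ Px (P⇒≡ ∘ there))

∑-cartesianProductWith : (g : A → B → C) (xs : List A) (ys : List B) (f : C → ℕ) →
                         ∑ (cartesianProductWith g xs ys) f ≡ ∑[ x ∈ xs ] ∑[ y ∈ ys ] f (g x y)
∑-cartesianProductWith g []       ys f = refl
∑-cartesianProductWith g (x ∷ xs) ys f = begin
  ∑ (map (g x) ys ++ cartesianProductWith g xs ys) f
    ≡⟨ ∑-++ (map (g x) ys) _ f ⟩
  ∑ (map (g x) ys) f + ∑ (cartesianProductWith g xs ys) f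
    ≡⟨ cong₂ _+_ (∑-map (g x) ys f) (∑-cartesianProductWith g xs ys f) ⟩
  ∑[ y ∈ ys ] f (g x y) + ∑[ x ∈ xs ] ∑[ y ∈ ys ] f (g x y) ∎
  where open ≡-Reasoning

∑-downFrom-< : ∀ R m → ∑[ q ∈ downFrom R ] 𝟙 (q <? m) ≡ R ⊓ m
∑-downFrom-< zero    m = refl
∑-downFrom-< (suc R) m with R <? m
... | yes R<m = trans (cong suc (trans (∑-downFrom-< R m) (m≤n⇒m⊓n≡m (<⇒≤ R<m))))
                      (sym (m≤n⇒m⊓n≡m R<m))
... | no R≮m  = trans (∑-downFrom-< R m) (trans (m≥n⇒m⊓n≡n (≮⇒≥ R≮m))
                      (sym (m≥n⇒m⊓n≡n (≤-trans (≮⇒≥ R≮m) (n≤1+n R)))))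

∑-downFrom-> : ∀ R m → ∑[ q ∈ downFrom R ] 𝟙 (m <? q) ≡ R ∸ suc m
∑-downFrom-> zero    m = refl
∑-downFrom-> (suc R) m with m <? R
... | yes m<R = trans (cong suc (∑-downFrom-> R m)) (sym (+-∸-assoc 1 m<R))
... | no m≮R  = trans (∑-downFrom-> R m) (trans (m≤n⇒m∸n≡0 (≤-trans (≮⇒≥ m≮R) (n≤1+n m)))
                      (sym (m≤n⇒m∸n≡0 (≮⇒≥ m≮R))))

unique∧same-elements⇒↭ : {xs ys : List A} → Unique xs → Unique ys →
                         (∀ {z} → z ∈ xs → z ∈ ys) → (∀ {z} → z ∈ ys → z ∈ xs) → xs ↭ ys
unique∧same-elements⇒↭ xs! ys! xs⊆ys ys⊆xs = ∼bag⇒↭ (unique∧set⇒bag xs! ys! (mk⇔ xs⊆ys ys⊆xs))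

module Complement {A : Set ℓ} (_≟ᴬ_ : DecidableEquality A) where

  open import Data.List.Membership.DecPropositional _≟ᴬ_ using (_∈?_; _∉?_)

  complement : List A → List A → List A
  complement xs ys = filter (_∉? ys) xs

  ∈-complement⁻ : {xs ys : List A} {z : A} → z ∈ complement xs ys → z ∉ ys
  ∈-complement⁻ {xs} {ys} z∈c = proj₂ (∈-filter⁻ (_∉? ys) {xs = xs} z∈c)

  ↭-++-complement : {xs ys : List A} → Unique xs → Unique ys → (∀ {z} → z ∈ ys → z ∈ xs) →
                    xs ↭ ys ++ complement xs ys
  ↭-++-complement {xs} {ys} xs! ys! ys⊆xs =
    unique∧same-elements⇒↭ xs! (Unique.++⁺ ys! (Unique.filter⁺ (_∉? ys) xs!) disjoint) to from
    where
    disjoint : ∀ {z} → ¬ (z ∈ ys × z ∈ complement xs ys)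
    disjoint (z∈ys , z∈c) = ∈-complement⁻ {xs} z∈c z∈ys
    to : ∀ {z} → z ∈ xs → z ∈ ys ++ complement xs ys
    to {z} z∈xs with z ∉? ys
    ... | yes z∉ys = ∈-++⁺ʳ ys (∈-filter⁺ (_∉? ys) z∈xs z∉ys)
    ... | no ¬z∉ys = ∈-++⁺ˡ (decidable-stable (z ∈? ys) ¬z∉ys)
    from : ∀ {z} → z ∈ ys ++ complement xs ys → z ∈ xs
    from z∈ with ∈-++⁻ ys z∈
    ... | inj₁ z∈ys = ys⊆xs z∈ys
    ... | inj₂ z∈c  = proj₁ (∈-filter⁻ (_∉? ys) {xs = xs} z∈c)

weighted-sum-cong : ∀ c d e {x y z x′ y′ z′} → x ≡ x′ → y ≡ y′ → z ≡ z′ →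
                    c * x + d * y + e * z ≡ c * x′ + d * y′ + e * z′
weighted-sum-cong c d e refl refl refl = refl

*-cong-or-zero : ∀ c {x y} → c ≡ 0 ⊎ x ≡ y → c * x ≡ c * y
*-cong-or-zero c (inj₁ refl) = refl
*-cong-or-zero c (inj₂ refl) = refl

coefficients-sum : ∀ {n L t} → t < L → L ≤ suc n → (suc n ∸ L) + (L ∸ suc t) + t ≡ n
coefficients-sum {n} {L} {t} t<L L≤1+n = suc-injective (begin
  suc ((suc n ∸ L) + (L ∸ suc t) + t)   ≡⟨ +-suc _ t ⟨
  (suc n ∸ L) + (L ∸ suc t) + suc t     ≡⟨ +-assoc (suc n ∸ L) _ _ ⟩
  (suc n ∸ L) + ((L ∸ suc t) + suc t)   ≡⟨ cong (suc n ∸ L +_) (m∸n+n≡m t<L) ⟩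
  (suc n ∸ L) + L                       ≡⟨ m∸n+n≡m L≤1+n ⟩
  suc n                                 ∎)
  where open ≡-Reasoning

m∣n∧0<n<m+m⇒n≡m : ∀ {m n} → m ∣ n → 0 < n → n < m + m → n ≡ m
m∣n∧0<n<m+m⇒n≡m     (divides zero refl)          ()
m∣n∧0<n<m+m⇒n≡m {m} (divides (suc zero) refl)    _ _      = +-identityʳ m
m∣n∧0<n<m+m⇒n≡m {m} (divides (suc (suc q)) refl) _ n<m+m =
  ⊥-elim (<⇒≱ n<m+m (+-monoʳ-≤ m (m≤m+n m (q * m))))

IsLeastPositive : Pred ℕ ℓ → ℕ → Set ℓ
IsLeastPositive P m = 1 ≤ m × P m × (∀ {s} → s < m → 1 ≤ s → ¬ P s)

leastPositive-unique : {P : Pred ℕ ℓ} {m m′ : ℕ} →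
                       IsLeastPositive P m → IsLeastPositive P m′ → m ≡ m′
leastPositive-unique {m = m} {m′} (1≤m , Pm , m-least) (1≤m′ , Pm′ , m′-least) with <-cmp m m′
... | tri< m<m′ _ _ = ⊥-elim (m′-least m<m′ 1≤m Pm)
... | tri≈ _ m≡m′ _ = m≡m′
... | tri> _ _ m′<m = ⊥-elim (m-least m′<m 1≤m′ Pm′)

module _ {P : Pred ℕ ℓ} (P? : Decidable P) where

  isLeastPositive? : Decidable (IsLeastPositive P)
  isLeastPositive? m = (1 ≤? m) ×-dec P? m ×-dec allUpTo? (λ s → (1 ≤? s) →-dec ¬? (P? s)) m

  private
    search : ∀ b → ∃ (IsLeastPositive P) ⊎ (∀ {s} → s < b → 1 ≤ s → ¬ P s)
    search zero = inj₂ λ ()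
    search (suc b) with search b
    ... | inj₁ found = inj₁ found
    ... | inj₂ none with (1 ≤? b) ×-dec P? b
    ...   | yes (1≤b , Pb) = inj₁ (b , 1≤b , Pb , none)
    ...   | no ¬[1≤b×Pb]  = inj₂ none′
      where
      none′ : ∀ {s} → s < suc b → 1 ≤ s → ¬ P s
      none′ s<1+b 1≤s Ps with m<1+n⇒m<n∨m≡n s<1+b
      ... | inj₁ s<b  = none s<b 1≤s Ps
      ... | inj₂ refl = ¬[1≤b×Pb] (1≤s , Ps)

  leastPositive-exists : ∀ {d} → 1 ≤ d → P d → ∃ (IsLeastPositive P)
  leastPositive-exists {d} 1≤d Pd with search (suc d)
  ... | inj₁ found = found
  ... | inj₂ none  = ⊥-elim (none ≤-refl 1≤d Pd)

-- Permutations of [n] as vectors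

Unique-toList⁻ : ∀ {n} {v : Vec A n} → Unique (toList v) → Vec.Unique v
Unique-toList⁻ {v = []}    []       = []
Unique-toList⁻ {v = _ ∷ _} (x∉ ∷ u) = VecAll.toList⁻ x∉ ∷ Unique-toList⁻ u

Unique-toList⁺ : ∀ {n} {v : Vec A n} → Vec.Unique v → Unique (toList v)
Unique-toList⁺ []       = []
Unique-toList⁺ (x∉ ∷ u) = VecAll.toList⁺ x∉ ∷ Unique-toList⁺ u

isPerm⇒lookup-injective : ∀ {n} {π : Vec (Fin n) n} → IsPerm π →
                          ∀ {a b} → lookup π a ≡ lookup π b → a ≡ b
isPerm⇒lookup-injective π-perm = VecUnique.lookup-injective (Unique-toList⁻ π-perm) _ _

tabulate-isPerm : ∀ {n} {f : Fin n → Fin n} → (∀ {a b} → f a ≡ f b → a ≡ b) → IsPerm (tabulate f)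
tabulate-isPerm f-inj = Unique-toList⁺ (VecUnique.tabulate⁺ f-inj)

lookup-ext : ∀ {n} {v w : Vec A n} → (∀ a → lookup v a ≡ lookup w a) → v ≡ w
lookup-ext {v = v} {w} v≗w =
  trans (sym (tabulate∘lookup v)) (trans (tabulate-cong v≗w) (tabulate∘lookup w))

concatMap-map≡cartesianProductWith : (f : A → B → C) (xs : List A) (ys : List B) →
  concatMap (λ x → map (f x) ys) xs ≡ cartesianProductWith f xs ys
concatMap-map≡cartesianProductWith f []       ys = refl
concatMap-map≡cartesianProductWith f (x ∷ xs) ys =
  cong (map (f x) ys ++_) (concatMap-map≡cartesianProductWith f xs ys)

allVecs-suc : ∀ n m → allVecs (suc n) m ≡ cartesianProductWith _∷_ (allFin m) (allVecs n m)
allVecs-suc n m = concatMap-map≡cartesianProductWith _∷_ (allFin m) (allVecs n m)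

∈-allVecs : ∀ {n m} (v : Vec (Fin m) n) → v ∈ allVecs n m
∈-allVecs []      = here refl
∈-allVecs {suc n} {m} (x ∷ v) =
  subst ((x ∷ v) ∈_) (sym (allVecs-suc n m)) (∈-cartesianProductWith⁺ _∷_ (∈-allFin x) (∈-allVecs v))

allVecs-Unique : ∀ n m → Unique (allVecs n m)
allVecs-Unique zero    m = [] ∷ []
allVecs-Unique (suc n) m = subst Unique (sym (allVecs-suc n m))
  (Unique.cartesianProductWith⁺ _∷_ ∷-injective (Unique.allFin⁺ m) (allVecs-Unique n m))

Sym-Unique : ∀ n → Unique (Sym n)
Sym-Unique n = Unique.filter⁺ isPerm? (allVecs-Unique n n)

∈-Sym⁺ : ∀ {n} {π : Vec (Fin n) n} → IsPerm π → π ∈ Sym n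
∈-Sym⁺ π-perm = ∈-filter⁺ isPerm? (∈-allVecs _) π-perm

∈-Sym⁻ : ∀ {n} {π : Vec (Fin n) n} → π ∈ Sym n → IsPerm π
∈-Sym⁻ {n} π∈ = proj₂ (∈-filter⁻ isPerm? {xs = allVecs n n} π∈)

module _ {n : ℕ} where

  transpose-matchˡ : (c d : Fin n) → transpose c d c ≡ d
  transpose-matchˡ c d with c ≟ c
  ... | yes _   = refl
  ... | no c≢c = ⊥-elim (c≢c refl)

  transpose-matchʳ : (c d : Fin n) → transpose c d d ≡ c
  transpose-matchʳ c d with d ≟ c
  ... | yes refl = refl
  ... | no _ with d ≟ d
  ...   | yes _   = refl
  ...   | no d≢d = ⊥-elim (d≢d refl)

  transpose-mismatch : {c d e : Fin n} → e ≢ c → e ≢ d → transpose c d e ≡ e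
  transpose-mismatch {c} {d} {e} e≢c e≢d with e ≟ c
  ... | yes e≡c = ⊥-elim (e≢c e≡c)
  ... | no _ with e ≟ d
  ...   | yes e≡d = ⊥-elim (e≢d e≡d)
  ...   | no _    = refl

  transpose-injective : (c d : Fin n) {e f : Fin n} → transpose c d e ≡ transpose c d f → e ≡ f
  transpose-injective c d {e} {f} eq =
    trans (sym (transpose-inverse d c)) (trans (cong (transpose d c) eq) (transpose-inverse d c))

module Insertion {n : ℕ} (x : Fin (suc n)) where

  extend : Vec (Fin n) n → Fin (suc n) → Fin (suc n)
  extend σ z with x ≟ z
  ... | yes _   = x
  ... | no x≢z = punchIn x (lookup σ (punchOut x≢z))

  extend-x : (σ : Vec (Fin n) n) → extend σ x ≡ x
  extend-x σ with x ≟ x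
  ... | yes _   = refl
  ... | no x≢x = ⊥-elim (x≢x refl)

  extend-punchIn : (σ : Vec (Fin n) n) (z : Fin n) →
                   extend σ (punchIn x z) ≡ punchIn x (lookup σ z)
  extend-punchIn σ z with x ≟ punchIn x z
  ... | yes x≡ = ⊥-elim (punchInᵢ≢i x z (sym x≡))
  ... | no x≢ = cong (punchIn x ∘ lookup σ) (trans (punchOut-cong x refl) (punchOut-punchIn x))

  extend-injective : {σ : Vec (Fin n) n} → IsPerm σ → ∀ {a b} → extend σ a ≡ extend σ b → a ≡ b
  extend-injective {σ} σ-perm {a} {b} eq with x ≟ a | x ≟ b
  ... | yes x≡a | yes x≡b = trans (sym x≡a) x≡b
  ... | yes _   | no _    = ⊥-elim (punchInᵢ≢i x _ (sym eq))
  ... | no _    | yes _   = ⊥-elim (punchInᵢ≢i x _ eq)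
  ... | no x≢a  | no x≢b  =
    punchOut-injective x≢a x≢b (isPerm⇒lookup-injective σ-perm (punchIn-injective x _ _ eq))

  -- σ, acting on the points ≠ x through punchIn x, followed by the transposition (x c): this puts x
  -- on the cycle of c, just before c (for c = x, as a fixed point).
  insert : Vec (Fin n) n → Fin (suc n) → Vec (Fin (suc n)) (suc n)
  insert σ c = tabulate (transpose x c ∘ extend σ)

  lookup-insert-x : (σ : Vec (Fin n) n) (c : Fin (suc n)) → lookup (insert σ c) x ≡ c
  lookup-insert-x σ c = begin
    lookup (insert σ c) x     ≡⟨ lookup∘tabulate (transpose x c ∘ extend σ) x ⟩
    transpose x c (extend σ x) ≡⟨ cong (transpose x c) (extend-x σ) ⟩
    transpose x c x            ≡⟨ transpose-matchˡ x c ⟩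
    c                          ∎
    where open ≡-Reasoning

  lookup-insert-punchIn : (σ : Vec (Fin n) n) (c : Fin (suc n)) (z : Fin n) →
                          lookup (insert σ c) (punchIn x z) ≡ transpose x c (punchIn x (lookup σ z))
  lookup-insert-punchIn σ c z = trans (lookup∘tabulate (transpose x c ∘ extend σ) (punchIn x z))
                                      (cong (transpose x c) (extend-punchIn σ z))

  insert-hit : (σ : Vec (Fin n) n) (z : Fin n) →
               lookup (insert σ (punchIn x (lookup σ z))) (punchIn x z) ≡ x
  insert-hit σ z = trans (lookup-insert-punchIn σ _ z) (transpose-matchʳ x (punchIn x (lookup σ z)))

  insert-miss : (σ : Vec (Fin n) n) {c : Fin (suc n)} (z : Fin n) → c ≢ punchIn x (lookup σ z) →
                lookup (insert σ c) (punchIn x z) ≡ punchIn x (lookup σ z)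
  insert-miss σ z c≢ =
    trans (lookup-insert-punchIn σ _ z) (transpose-mismatch (punchInᵢ≢i x _) (c≢ ∘ sym))

  insert-isPerm : {σ : Vec (Fin n) n} → IsPerm σ → (c : Fin (suc n)) → IsPerm (insert σ c)
  insert-isPerm σ-perm c = tabulate-isPerm (extend-injective σ-perm ∘ transpose-injective x c)

  insert-injective : ∀ {σ τ c d} → insert σ c ≡ insert τ d → σ ≡ τ × c ≡ d
  insert-injective {σ} {τ} {c} {d} eq = lookup-ext σ≗τ , c≡d
    where
    c≡d : c ≡ d
    c≡d = trans (sym (lookup-insert-x σ c)) (trans (cong (λ π → lookup π x) eq) (lookup-insert-x τ d))
    σ≗τ : ∀ z → lookup σ z ≡ lookup τ z
    σ≗τ z = punchIn-injective x _ _ (transpose-injective x d (begin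
      transpose x d (punchIn x (lookup σ z)) ≡⟨ cong (λ e → transpose x e (punchIn x (lookup σ z))) c≡d ⟨
      transpose x c (punchIn x (lookup σ z)) ≡⟨ lookup-insert-punchIn σ c z ⟨
      lookup (insert σ c) (punchIn x z)      ≡⟨ cong (λ π → lookup π (punchIn x z)) eq ⟩
      lookup (insert τ d) (punchIn x z)      ≡⟨ lookup-insert-punchIn τ d z ⟩
      transpose x d (punchIn x (lookup τ z)) ∎))
      where open ≡-Reasoning

  module _ (π : Vec (Fin (suc n)) (suc n)) (π-perm : IsPerm π) where

    private
      untranspose : Fin n → Fin (suc n)
      untranspose z = transpose (lookup π x) x (lookup π (punchIn x z))

      x≢untranspose : ∀ z → x ≢ untranspose z
      x≢untranspose z x≡ = punchInᵢ≢i x z (isPerm⇒lookup-injective π-perm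
        (transpose-injective (lookup π x) x (trans (sym x≡) (sym (transpose-matchˡ (lookup π x) x)))))

    remove : Vec (Fin n) n
    remove = tabulate (λ z → punchOut (x≢untranspose z))

    private
      punchIn-lookup-remove : ∀ z → punchIn x (lookup remove z) ≡ untranspose z
      punchIn-lookup-remove z = trans (cong (punchIn x) (lookup∘tabulate _ z)) (punchIn-punchOut _)

    remove-isPerm : IsPerm remove
    remove-isPerm = tabulate-isPerm λ {a} {b} eq → punchIn-injective x a b
      (isPerm⇒lookup-injective π-perm (transpose-injective (lookup π x) x
        (punchOut-injective (x≢untranspose a) (x≢untranspose b) eq)))

    insert-remove : insert remove (lookup π x) ≡ π
    insert-remove = lookup-ext agree
      where
      open ≡-Reasoning
      agree-punchIn : ∀ z → lookup (insert remove (lookup π x)) (punchIn x z) ≡ lookup π (punchIn x z)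
      agree-punchIn z = begin
        lookup (insert remove (lookup π x)) (punchIn x z)
          ≡⟨ lookup-insert-punchIn remove (lookup π x) z ⟩
        transpose x (lookup π x) (punchIn x (lookup remove z))
          ≡⟨ cong (transpose x (lookup π x)) (punchIn-lookup-remove z) ⟩
        transpose x (lookup π x) (untranspose z)
          ≡⟨ transpose-inverse x (lookup π x) ⟩
        lookup π (punchIn x z) ∎
      agree : ∀ z → lookup (insert remove (lookup π x)) z ≡ lookup π z
      agree z with x ≟ z
      ... | yes refl = lookup-insert-x remove (lookup π x)
      ... | no x≢z  = begin
        lookup (insert remove (lookup π x)) z
          ≡⟨ cong (lookup (insert remove (lookup π x))) (punchIn-punchOut x≢z) ⟨
        lookup (insert remove (lookup π x)) (punchIn x (punchOut x≢z))
          ≡⟨ agree-punchIn (punchOut x≢z) ⟩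
        lookup π (punchIn x (punchOut x≢z))
          ≡⟨ cong (lookup π) (punchIn-punchOut x≢z) ⟩
        lookup π z ∎

  Sym-suc↭ : Sym (suc n) ↭ cartesianProductWith insert (Sym n) (allFin (suc n))
  Sym-suc↭ = unique∧same-elements⇒↭ (Sym-Unique (suc n))
    (Unique.cartesianProductWith⁺ insert insert-injective (Sym-Unique n) (Unique.allFin⁺ (suc n))) to from
    where
    to : ∀ {π} → π ∈ Sym (suc n) → π ∈ cartesianProductWith insert (Sym n) (allFin (suc n))
    to {π} π∈ = subst (_∈ _) (insert-remove π (∈-Sym⁻ π∈))
      (∈-cartesianProductWith⁺ insert (∈-Sym⁺ (remove-isPerm π (∈-Sym⁻ π∈))) (∈-allFin (lookup π x)))
    from : ∀ {π} → π ∈ cartesianProductWith insert (Sym n) (allFin (suc n)) → π ∈ Sym (suc n)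
    from π∈ with σ , c , σ∈ , _ , refl ← ∈-cartesianProductWith⁻ insert (Sym n) (allFin (suc n)) π∈ =
      ∈-Sym⁺ (insert-isPerm (∈-Sym⁻ σ∈) c)

  count-Sym-suc : {P : Pred (Vec (Fin (suc n)) (suc n)) ℓ} (P? : Decidable P) →
    length (filter P? (Sym (suc n))) ≡ ∑[ σ ∈ Sym n ] ∑[ c ∈ allFin (suc n) ] 𝟙 (P? (insert σ c))
  count-Sym-suc P? = begin
    length (filter P? (Sym (suc n)))
      ≡⟨ length-filter≡∑𝟙 P? (Sym (suc n)) ⟩
    ∑[ π ∈ Sym (suc n) ] 𝟙 (P? π)
      ≡⟨ ∑-↭ Sym-suc↭ (𝟙 ∘ P?) ⟩
    ∑[ π ∈ cartesianProductWith insert (Sym n) (allFin (suc n)) ] 𝟙 (P? π)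
      ≡⟨ ∑-cartesianProductWith insert (Sym n) _ (𝟙 ∘ P?) ⟩
    ∑[ σ ∈ Sym n ] ∑[ c ∈ allFin (suc n) ] 𝟙 (P? (insert σ c)) ∎
    where open ≡-Reasoning

-- Cycles

module _ {n : ℕ} (π : Vec (Fin n) n) where

  iter-+ : ∀ a b i → iter π (a + b) i ≡ iter π a (iter π b i)
  iter-+ zero    b i = refl
  iter-+ (suc a) b i = cong (lookup π) (iter-+ a b i)

  iter-injective : IsPerm π → ∀ a {i j} → iter π a i ≡ iter π a j → i ≡ j
  iter-injective π-perm zero    eq = eq
  iter-injective π-perm (suc a) eq = iter-injective π-perm a (isPerm⇒lookup-injective π-perm eq)

  IsCycleLength : Fin n → ℕ → Set
  IsCycleLength i = IsLeastPositive (λ s → iter π s i ≡ i)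

  isCycleLength? : ∀ i → Decidable (IsCycleLength i)
  isCycleLength? i = isLeastPositive? (λ s → iter π s i ≟ i)

  cycleLength-exists : IsPerm π → ∀ i → ∃ (IsCycleLength i)
  cycleLength-exists π-perm i
    with a , b , a<b , eq ← pigeonhole (n<1+n n) (λ s → iter π (toℕ s) i)
    with d , a+d≡b ← m≤n⇒∃[o]m+o≡n (<⇒≤ a<b) =
    leastPositive-exists (λ s → iter π s i ≟ i) 1≤d (sym (iter-injective π-perm (toℕ a) (begin
      iter π (toℕ a) i             ≡⟨ eq ⟩
      iter π (toℕ b) i             ≡⟨ cong (λ s → iter π s i) a+d≡b ⟨
      iter π (toℕ a + d) i         ≡⟨ iter-+ (toℕ a) d i ⟩
      iter π (toℕ a) (iter π d i)  ∎)))
    where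
    open ≡-Reasoning
    1≤d : 1 ≤ d
    1≤d = n≢0⇒n>0 λ { refl → <-irrefl (trans (sym (+-identityʳ (toℕ a))) a+d≡b) a<b }

  module _ {i : Fin n} {R : ℕ} (R-cycle : IsCycleLength i R) where

    iter-*-cycleLength : ∀ q → iter π (q * R) i ≡ i
    iter-*-cycleLength zero    = refl
    iter-*-cycleLength (suc q) = trans (iter-+ R (q * R) i)
      (trans (cong (iter π R) (iter-*-cycleLength q)) (proj₁ (proj₂ R-cycle)))

    iter-+-*-cycleLength : ∀ s q → iter π (s + q * R) i ≡ iter π s i
    iter-+-*-cycleLength s q = trans (iter-+ s (q * R) i) (cong (iter π s) (iter-*-cycleLength q))

    private
      R-least : ∀ {s} → s < R → 1 ≤ s → iter π s i ≢ i
      R-least = proj₂ (proj₂ R-cycle)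

      instance
        R-nonZero : NonZero R
        R-nonZero = >-nonZero (proj₁ R-cycle)

    iter-%-cycleLength : ∀ s → iter π (s % R) i ≡ iter π s i
    iter-%-cycleLength s = trans (sym (iter-+-*-cycleLength (s % R) (s / R)))
                                 (cong (λ s → iter π s i) (sym (m≡m%n+[m/n]*n s R)))

    cycleLength-∣ : ∀ {s} → iter π s i ≡ i → R ∣ s
    cycleLength-∣ {s} πˢi≡i = m%n≡0⇒n∣m s R (n<1⇒n≡0 (≰⇒> λ 1≤s%R →
      R-least (m%n<n s R) 1≤s%R (trans (iter-%-cycleLength s) πˢi≡i)))

    private
      iter-injective-≤ : IsPerm π → ∀ {a b} → a ≤ b → b < R → iter π a i ≡ iter π b i → a ≡ b
      iter-injective-≤ π-perm {a} a≤b b<R eq with m≤n⇒∃[o]m+o≡n a≤b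
      ... | zero  , a+0≡b = trans (sym (+-identityʳ a)) a+0≡b
      ... | suc d , refl  = ⊥-elim (R-least (≤-<-trans (m≤n+m (suc d) a) b<R) (s≤s z≤n)
                              (sym (iter-injective π-perm a (trans eq (iter-+ a (suc d) i)))))

    iter-injective-below-cycleLength : IsPerm π → ∀ {a b} → a < R → b < R →
                                       iter π a i ≡ iter π b i → a ≡ b
    iter-injective-below-cycleLength π-perm {a} {b} a<R b<R eq with ≤-total a b
    ... | inj₁ a≤b = iter-injective-≤ π-perm a≤b b<R eq
    ... | inj₂ b≤a = sym (iter-injective-≤ π-perm b≤a a<R (sym eq))

module _ {n : ℕ} where

  CycleStep : Vec (Fin n) n → Fin n → Fin n → ℕ → ℕ → Set
  CycleStep π i j L t = IsCycleLength π i L × iter π t i ≡ j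

  cycleStep? : (i j : Fin n) (L t : ℕ) → Decidable (λ π → CycleStep π i j L t)
  cycleStep? i j L t π = isCycleLength? π i L ×-dec (iter π t i ≟ j)

  module _ {π : Vec (Fin n) n} {i : Fin n} {R : ℕ} (R-cycle : IsCycleLength π i R) where

    𝟙-cycleStep-≢ : ∀ {L} → L ≢ R → ∀ j t → 𝟙 (cycleStep? i j L t π) ≡ 0
    𝟙-cycleStep-≢ L≢R j t =
      𝟙-no (cycleStep? i j _ t π) λ (L-cycle , _) → L≢R (leastPositive-unique L-cycle R-cycle)

    𝟙-cycleStep-≡ : ∀ j t → 𝟙 (cycleStep? i j R t π) ≡ 𝟙 (iter π t i ≟ j)
    𝟙-cycleStep-≡ j t = 𝟙-cong (cycleStep? i j R t π) (iter π t i ≟ j) proj₂ (R-cycle ,_)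

cycleStepCount : (n : ℕ) → Fin n → Fin n → ℕ → ℕ → ℕ
cycleStepCount n i j L t = length (filter (cycleStep? i j L t) (Sym n))

𝟙-≟-punchIn : ∀ {n} (x : Fin (suc n)) {w : Fin (suc n)} {z : Fin n} (j : Fin n) →
              w ≡ punchIn x z → 𝟙 (w ≟ punchIn x j) ≡ 𝟙 (z ≟ j)
𝟙-≟-punchIn x j refl = 𝟙-cong (_ ≟ _) (_ ≟ _) (punchIn-injective x _ _) (cong (punchIn x))

module InsertionIntoCycle {n : ℕ} (x : Fin (suc n)) {σ : Vec (Fin n) n} (σ-perm : IsPerm σ)
                          {i : Fin n} {R : ℕ} (R-cycle : IsCycleLength σ i R) where

  open Insertion x

  private
    R-least : ∀ {s} → s < R → 1 ≤ s → iter σ s i ≢ i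
    R-least = proj₂ (proj₂ R-cycle)

    σᴿi≡i : iter σ R i ≡ i
    σᴿi≡i = proj₁ (proj₂ R-cycle)

  orbitPoint : ℕ → Fin (suc n)
  orbitPoint q = punchIn x (iter σ (suc q) i)

  orbitPoint-injective : ∀ {q q′} → q < R → q′ < R → orbitPoint q ≡ orbitPoint q′ → q ≡ q′
  orbitPoint-injective q<R q′<R eq = iter-injective-below-cycleLength σ R-cycle σ-perm q<R q′<R
    (isPerm⇒lookup-injective σ-perm (punchIn-injective x _ _ eq))

  orbit : List (Fin (suc n))
  orbit = applyDownFrom orbitPoint R

  orbit-Unique : Unique orbit
  orbit-Unique = Unique.applyDownFrom⁺₁ orbitPoint R λ q′<q q<R eq →
    <-irrefl (sym (orbitPoint-injective q<R (<-trans q′<q q<R) eq)) q′<q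

  module Outside {c : Fin (suc n)} (c∉orbit : ∀ {q} → q < R → c ≢ orbitPoint q) where

    iter-insert : ∀ {s} → s ≤ R → iter (insert σ c) s (punchIn x i) ≡ punchIn x (iter σ s i)
    iter-insert {zero}  _     = refl
    iter-insert {suc s} 1+s≤R = trans (cong (lookup (insert σ c)) (iter-insert (<⇒≤ 1+s≤R)))
                                      (insert-miss σ (iter σ s i) (c∉orbit 1+s≤R))

    cycleLength-insert : IsCycleLength (insert σ c) (punchIn x i) R
    cycleLength-insert = proj₁ R-cycle , trans (iter-insert ≤-refl) (cong (punchIn x) σᴿi≡i) ,
      λ s<R 1≤s eq → R-least s<R 1≤s (punchIn-injective x _ _ (trans (sym (iter-insert (<⇒≤ s<R))) eq))

    𝟙-cycleStep-insert : ∀ j {L t} → t < L →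
      𝟙 (cycleStep? (punchIn x i) (punchIn x j) L t (insert σ c)) ≡ 𝟙 (cycleStep? i j L t σ)
    𝟙-cycleStep-insert j {L} {t} t<L with L ℕ.≟ R
    ... | no L≢R = trans (𝟙-cycleStep-≢ cycleLength-insert L≢R _ t) (sym (𝟙-cycleStep-≢ R-cycle L≢R j t))
    ... | yes refl = begin
      𝟙 (cycleStep? (punchIn x i) (punchIn x j) R t (insert σ c))  ≡⟨ 𝟙-cycleStep-≡ cycleLength-insert _ t ⟩
      𝟙 (iter (insert σ c) t (punchIn x i) ≟ punchIn x j)         ≡⟨ 𝟙-≟-punchIn x j (iter-insert (<⇒≤ t<L)) ⟩
      𝟙 (iter σ t i ≟ j)                                           ≡⟨ 𝟙-cycleStep-≡ R-cycle j t ⟨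
      𝟙 (cycleStep? i j R t σ)                                     ∎
      where open ≡-Reasoning

  -- x is inserted between σ^q i and σ^(q+1) i, so the cycle of i grows by one.
  module Inside {q : ℕ} (q<R : q < R) where

    private
      π : Vec (Fin (suc n)) (suc n)
      π = insert σ (orbitPoint q)

      orbitPoint-≢ : ∀ {s} → s < R → s ≢ q → orbitPoint q ≢ orbitPoint s
      orbitPoint-≢ s<R s≢q eq = s≢q (sym (orbitPoint-injective q<R s<R eq))

    iter-insert-≤ : ∀ {s} → s ≤ q → iter π s (punchIn x i) ≡ punchIn x (iter σ s i)
    iter-insert-≤ {zero}  _     = refl
    iter-insert-≤ {suc s} 1+s≤q = trans (cong (lookup π) (iter-insert-≤ (<⇒≤ 1+s≤q)))
      (insert-miss σ (iter σ s i) (orbitPoint-≢ (<-trans 1+s≤q q<R) (<⇒≢ 1+s≤q)))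

    iter-insert-hit : iter π (suc q) (punchIn x i) ≡ x
    iter-insert-hit = trans (cong (lookup π) (iter-insert-≤ ≤-refl)) (insert-hit σ (iter σ q i))

    iter-insert-> : ∀ {s} → q < s → s ≤ R → iter π (suc s) (punchIn x i) ≡ punchIn x (iter σ s i)
    iter-insert-> {suc s} (s≤s q≤s) 1+s≤R with m≤n⇒m<n∨m≡n q≤s
    ... | inj₂ refl = trans (cong (lookup π) iter-insert-hit) (lookup-insert-x σ (orbitPoint q))
    ... | inj₁ q<s  = trans (cong (lookup π) (iter-insert-> q<s (<⇒≤ 1+s≤R)))
      (insert-miss σ (iter σ s i) (orbitPoint-≢ 1+s≤R (≢-sym (<⇒≢ q<s))))

    cycleLength-insert : IsCycleLength π (punchIn x i) (suc R)
    cycleLength-insert = s≤s z≤n , trans (iter-insert-> q<R ≤-refl) (cong (punchIn x) σᴿi≡i) , least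
      where
      least : ∀ {s} → s < suc R → 1 ≤ s → iter π s (punchIn x i) ≢ punchIn x i
      least {s} s<1+R 1≤s eq with <-cmp s (suc q)
      ... | tri< (s≤s s≤q) _ _ = R-least (≤-<-trans s≤q q<R) 1≤s
            (punchIn-injective x _ _ (trans (sym (iter-insert-≤ s≤q)) eq))
      ... | tri≈ _ refl _ = punchInᵢ≢i x i (trans (sym eq) iter-insert-hit)
      least {suc s} (s≤s s<R) _ eq | tri> _ _ (s≤s q<s) = R-least s<R (≤-trans (s≤s z≤n) q<s)
            (punchIn-injective x _ _ (trans (sym (iter-insert-> q<s (<⇒≤ s<R))) eq))

    𝟙-cycleStep-insert : ∀ j {t} → t < R →
      𝟙 (cycleStep? (punchIn x i) (punchIn x j) (suc R) (suc t) π)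
        ≡ 𝟙 (t <? q) * 𝟙 (iter σ (suc t) i ≟ j) + 𝟙 (q <? t) * 𝟙 (iter σ t i ≟ j)
    𝟙-cycleStep-insert j {t} t<R =
      trans (𝟙-cycleStep-≡ cycleLength-insert _ (suc t)) (by-position (<-cmp t q))
      where
      a b : ℕ
      a = 𝟙 (iter σ (suc t) i ≟ j)
      b = 𝟙 (iter σ t i ≟ j)
      weights : ∀ {u v} → 𝟙 (t <? q) ≡ u → 𝟙 (q <? t) ≡ v →
                𝟙 (t <? q) * a + 𝟙 (q <? t) * b ≡ u * a + v * b
      weights refl refl = refl
      by-position : Tri (t < q) (t ≡ q) (q < t) →
        𝟙 (iter π (suc t) (punchIn x i) ≟ punchIn x j) ≡ 𝟙 (t <? q) * a + 𝟙 (q <? t) * b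
      by-position (tri< t<q _ ¬q<t) = trans (𝟙-≟-punchIn x j (iter-insert-≤ t<q))
        (sym (trans (weights (𝟙-yes _ t<q) (𝟙-no _ ¬q<t)) (trans (+-identityʳ _) (+-identityʳ a))))
      by-position (tri≈ ¬t<q refl ¬q<t) =
        trans (𝟙-no (_ ≟ _) λ eq → punchInᵢ≢i x j (trans (sym eq) iter-insert-hit))
              (sym (weights (𝟙-no _ ¬t<q) (𝟙-no _ ¬q<t)))
      by-position (tri> ¬t<q _ q<t) = trans (𝟙-≟-punchIn x j (iter-insert-> q<t (<⇒≤ t<R)))
        (sym (trans (weights (𝟙-no _ ¬t<q) (𝟙-yes _ q<t)) (+-identityʳ b)))

  open Complement (_≟_ {suc n})

  private
    outside : List (Fin (suc n))
    outside = complement (allFin (suc n)) orbit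

    allFin↭orbit++outside : allFin (suc n) ↭ orbit ++ outside
    allFin↭orbit++outside = ↭-++-complement (Unique.allFin⁺ (suc n)) orbit-Unique (λ _ → ∈-allFin _)

    length-outside : length outside ≡ suc n ∸ R
    length-outside = begin
      length outside                       ≡⟨ m+n∸m≡n R _ ⟨
      R + length outside ∸ R               ≡⟨ cong (λ m → m + length outside ∸ R) (length-applyDownFrom orbitPoint R) ⟨
      length orbit + length outside ∸ R    ≡⟨ cong (_∸ R) (length-++ orbit) ⟨
      length (orbit ++ outside) ∸ R        ≡⟨ cong (_∸ R) (↭.↭-length allFin↭orbit++outside) ⟨
      length (allFin (suc n)) ∸ R          ≡⟨ cong (_∸ R) (length-tabulate id) ⟩
      suc n ∸ R                            ∎
      where open ≡-Reasoning

    outside-∉ : ∀ {c} → c ∈ outside → ∀ {q} → q < R → c ≢ orbitPoint q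
    outside-∉ c∈ q<R refl = ∈-complement⁻ {xs = allFin (suc n)} c∈ (∈-applyDownFrom⁺ orbitPoint q<R)

  ∑-insert-cycleStep : ∀ j {L t} → t < L →
    ∑[ c ∈ allFin (suc n) ] 𝟙 (cycleStep? (punchIn x i) (punchIn x j) L t (insert σ c))
      ≡ ∑[ q ∈ downFrom R ] 𝟙 (cycleStep? (punchIn x i) (punchIn x j) L t (insert σ (orbitPoint q)))
        + (suc n ∸ R) * 𝟙 (cycleStep? i j L t σ)
  ∑-insert-cycleStep j {L} {t} t<L = begin
    ∑ (allFin (suc n)) F
      ≡⟨ ∑-↭ allFin↭orbit++outside F ⟩
    ∑ (orbit ++ outside) F
      ≡⟨ ∑-++ orbit outside F ⟩
    ∑ orbit F + ∑ outside F
      ≡⟨ cong (λ xs → ∑ xs F + ∑ outside F) (map-downFrom orbitPoint R) ⟨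
    ∑ (map orbitPoint (downFrom R)) F + ∑ outside F
      ≡⟨ cong₂ _+_ (∑-map orbitPoint (downFrom R) F)
                   (∑-cong outside λ c∈ → Outside.𝟙-cycleStep-insert (outside-∉ c∈) j t<L) ⟩
    ∑[ q ∈ downFrom R ] F (orbitPoint q) + ∑[ c ∈ outside ] 𝟙 (cycleStep? i j L t σ)
      ≡⟨ cong (∑[ q ∈ downFrom R ] F (orbitPoint q) +_)
              (trans (∑-const outside _) (cong (_* _) length-outside)) ⟩
    ∑[ q ∈ downFrom R ] F (orbitPoint q) + (suc n ∸ R) * 𝟙 (cycleStep? i j L t σ) ∎
    where
    open ≡-Reasoning
    F : Fin (suc n) → ℕ
    F c = 𝟙 (cycleStep? (punchIn x i) (punchIn x j) L t (insert σ c))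

  ∑-insert-cycleStep-grown : ∀ j {t} → t < R →
    ∑[ c ∈ allFin (suc n) ] 𝟙 (cycleStep? (punchIn x i) (punchIn x j) (suc R) (suc t) (insert σ c))
      ≡ (R ∸ suc t) * 𝟙 (iter σ (suc t) i ≟ j) + t * 𝟙 (iter σ t i ≟ j)
  ∑-insert-cycleStep-grown j {t} t<R = begin
    ∑[ c ∈ allFin (suc n) ] 𝟙 (cycleStep? (punchIn x i) (punchIn x j) (suc R) (suc t) (insert σ c))
      ≡⟨ ∑-insert-cycleStep j (s≤s t<R) ⟩
    ∑[ q ∈ downFrom R ] F q + (suc n ∸ R) * 𝟙 (cycleStep? i j (suc R) (suc t) σ)
      ≡⟨ cong₂ _+_ (∑-cong (downFrom R) λ q∈ → Inside.𝟙-cycleStep-insert (∈-downFrom⁻ q∈) j t<R)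
                   (trans (cong ((suc n ∸ R) *_) (𝟙-cycleStep-≢ R-cycle 1+n≢n j (suc t)))
                          (*-zeroʳ (suc n ∸ R))) ⟩
    ∑[ q ∈ downFrom R ] (𝟙 (t <? q) * a + 𝟙 (q <? t) * b) + 0
      ≡⟨ +-identityʳ _ ⟩
    ∑[ q ∈ downFrom R ] (𝟙 (t <? q) * a + 𝟙 (q <? t) * b)
      ≡⟨ ∑-+ (downFrom R) _ _ ⟩
    ∑[ q ∈ downFrom R ] (𝟙 (t <? q) * a) + ∑[ q ∈ downFrom R ] (𝟙 (q <? t) * b)
      ≡⟨ cong₂ _+_ (∑-*ʳ (downFrom R) _ a) (∑-*ʳ (downFrom R) _ b) ⟩
    ∑[ q ∈ downFrom R ] 𝟙 (t <? q) * a + ∑[ q ∈ downFrom R ] 𝟙 (q <? t) * b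
      ≡⟨ cong₂ (λ u v → u * a + v * b) (∑-downFrom-> R t)
                                       (trans (∑-downFrom-< R t) (m≥n⇒m⊓n≡n (<⇒≤ t<R))) ⟩
    (R ∸ suc t) * a + t * b ∎
    where
    open ≡-Reasoning
    F : ℕ → ℕ
    F q = 𝟙 (cycleStep? (punchIn x i) (punchIn x j) (suc R) (suc t) (insert σ (orbitPoint q)))
    a b : ℕ
    a = 𝟙 (iter σ (suc t) i ≟ j)
    b = 𝟙 (iter σ t i ≟ j)

  ∑-insert-cycleStep-kept : ∀ j {L t} → L ≡ R → t < L →
    ∑[ c ∈ allFin (suc n) ] 𝟙 (cycleStep? (punchIn x i) (punchIn x j) L t (insert σ c))
      ≡ (suc n ∸ L) * 𝟙 (cycleStep? i j L t σ)
  ∑-insert-cycleStep-kept j {t = t} refl t<R =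
    trans (∑-insert-cycleStep j t<R) (cong (_+ (suc n ∸ R) * 𝟙 (cycleStep? i j R t σ))
      (∑-zero (downFrom R) λ q∈ →
        𝟙-cycleStep-≢ (Inside.cycleLength-insert (∈-downFrom⁻ q∈)) (1+n≢n ∘ sym) (punchIn x j) t))

  ∑-insert-cycleStep-unrelated : ∀ j {L t} → L ≢ R → L ≢ suc R → t < L →
    ∑[ c ∈ allFin (suc n) ] 𝟙 (cycleStep? (punchIn x i) (punchIn x j) L t (insert σ c)) ≡ 0
  ∑-insert-cycleStep-unrelated j {L} {t} L≢R L≢1+R t<L = begin
    ∑[ c ∈ allFin (suc n) ] 𝟙 (cycleStep? (punchIn x i) (punchIn x j) L t (insert σ c))
      ≡⟨ ∑-insert-cycleStep j t<L ⟩
    ∑[ q ∈ downFrom R ] 𝟙 (cycleStep? (punchIn x i) (punchIn x j) L t (insert σ (orbitPoint q)))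
      + (suc n ∸ R) * 𝟙 (cycleStep? i j L t σ)
      ≡⟨ cong₂ _+_ (∑-zero (downFrom R) λ q∈ →
                      𝟙-cycleStep-≢ (Inside.cycleLength-insert (∈-downFrom⁻ q∈)) L≢1+R _ t)
                   (cong ((suc n ∸ R) *_) (𝟙-cycleStep-≢ R-cycle L≢R j t)) ⟩
    (suc n ∸ R) * 0
      ≡⟨ *-zeroʳ (suc n ∸ R) ⟩
    0 ∎
    where open ≡-Reasoning

  ∑-insert-cycleStep-recurrence : ∀ j {L t} → t < L →
    ∑[ c ∈ allFin (suc n) ] 𝟙 (cycleStep? (punchIn x i) (punchIn x j) (suc L) (suc t) (insert σ c))
      ≡ (n ∸ L) * 𝟙 (cycleStep? i j (suc L) (suc t) σ)
        + (L ∸ suc t) * 𝟙 (cycleStep? i j L (suc t) σ)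
        + t * 𝟙 (cycleStep? i j L t σ)
  ∑-insert-cycleStep-recurrence j {L} {t} t<L with L ℕ.≟ R | suc L ℕ.≟ R
  ... | yes refl | _ = begin
    _                                          ≡⟨ ∑-insert-cycleStep-grown j t<L ⟩
    (R ∸ suc t) * a + t * b                    ≡⟨ rearrange ((R ∸ suc t) * a) (t * b) (n ∸ R) ⟩
    (n ∸ R) * 0 + (R ∸ suc t) * a + t * b      ≡⟨ weighted-sum-cong (n ∸ R) (R ∸ suc t) t
                                                    (𝟙-cycleStep-≢ R-cycle 1+n≢n j (suc t))
                                                    (𝟙-cycleStep-≡ R-cycle j (suc t)) (𝟙-cycleStep-≡ R-cycle j t) ⟨
    _                                          ∎
    where
    open ≡-Reasoning
    a b : ℕ
    a = 𝟙 (iter σ (suc t) i ≟ j)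
    b = 𝟙 (iter σ t i ≟ j)
    rearrange : ∀ u v c → u + v ≡ c * 0 + u + v
    rearrange = solve-∀
  ... | no L≢R | yes 1+L≡R = begin
    _                                          ≡⟨ ∑-insert-cycleStep-kept j 1+L≡R (s≤s t<L) ⟩
    (n ∸ L) * X                                ≡⟨ rearrange ((n ∸ L) * X) (L ∸ suc t) t ⟩
    (n ∸ L) * X + (L ∸ suc t) * 0 + t * 0      ≡⟨ weighted-sum-cong (n ∸ L) (L ∸ suc t) t refl
                                                    (𝟙-cycleStep-≢ R-cycle L≢R j (suc t)) (𝟙-cycleStep-≢ R-cycle L≢R j t) ⟨
    _                                          ∎
    where
    open ≡-Reasoning
    X : ℕ
    X = 𝟙 (cycleStep? i j (suc L) (suc t) σ)
    rearrange : ∀ w d e → w ≡ w + d * 0 + e * 0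
    rearrange = solve-∀
  ... | no L≢R | no 1+L≢R = begin
    _                                          ≡⟨ ∑-insert-cycleStep-unrelated j 1+L≢R (L≢R ∘ suc-injective)
                                                                                (s≤s t<L) ⟩
    0                                          ≡⟨ rearrange (n ∸ L) (L ∸ suc t) t ⟩
    (n ∸ L) * 0 + (L ∸ suc t) * 0 + t * 0      ≡⟨ weighted-sum-cong (n ∸ L) (L ∸ suc t) t
                                                    (𝟙-cycleStep-≢ R-cycle 1+L≢R j (suc t))
                                                    (𝟙-cycleStep-≢ R-cycle L≢R j (suc t)) (𝟙-cycleStep-≢ R-cycle L≢R j t) ⟨
    _                                          ∎
    where
    open ≡-Reasoning
    rearrange : ∀ c d e → 0 ≡ c * 0 + d * 0 + e * 0
    rearrange = solve-∀

cycleStepCount-suc : ∀ {n} (x : Fin (suc n)) (i j : Fin n) {L t} → t < L →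
  cycleStepCount (suc n) (punchIn x i) (punchIn x j) (suc L) (suc t)
    ≡ (n ∸ L) * cycleStepCount n i j (suc L) (suc t)
      + (L ∸ suc t) * cycleStepCount n i j L (suc t)
      + t * cycleStepCount n i j L t
cycleStepCount-suc {n} x i j {L} {t} t<L = begin
  cycleStepCount (suc n) (punchIn x i) (punchIn x j) (suc L) (suc t)
    ≡⟨ count-Sym-suc (cycleStep? (punchIn x i) (punchIn x j) (suc L) (suc t)) ⟩
  ∑[ σ ∈ Sym n ] ∑[ c ∈ allFin (suc n) ] 𝟙 (cycleStep? (punchIn x i) (punchIn x j) (suc L) (suc t)
                                                       (insert σ c))
    ≡⟨ ∑-cong (Sym n) per-σ ⟩
  ∑[ σ ∈ Sym n ] (c₁ * f₁ σ + c₂ * f₂ σ + c₃ * f₃ σ)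
    ≡⟨ trans (∑-+ (Sym n) _ _) (cong (_+ ∑[ σ ∈ Sym n ] (c₃ * f₃ σ)) (∑-+ (Sym n) _ _)) ⟩
  ∑[ σ ∈ Sym n ] (c₁ * f₁ σ) + ∑[ σ ∈ Sym n ] (c₂ * f₂ σ) + ∑[ σ ∈ Sym n ] (c₃ * f₃ σ)
    ≡⟨ cong₂ _+_ (cong₂ _+_ (∑-*ˡ (Sym n) c₁ f₁) (∑-*ˡ (Sym n) c₂ f₂)) (∑-*ˡ (Sym n) c₃ f₃) ⟩
  c₁ * ∑ (Sym n) f₁ + c₂ * ∑ (Sym n) f₂ + c₃ * ∑ (Sym n) f₃
    ≡⟨ weighted-sum-cong c₁ c₂ c₃ (count≡∑ (suc L) (suc t)) (count≡∑ L (suc t)) (count≡∑ L t) ⟨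
  c₁ * cycleStepCount n i j (suc L) (suc t) + c₂ * cycleStepCount n i j L (suc t)
    + c₃ * cycleStepCount n i j L t ∎
  where
  open ≡-Reasoning
  open Insertion x
  c₁ c₂ c₃ : ℕ
  c₁ = n ∸ L
  c₂ = L ∸ suc t
  c₃ = t
  f₁ f₂ f₃ : Vec (Fin n) n → ℕ
  f₁ σ = 𝟙 (cycleStep? i j (suc L) (suc t) σ)
  f₂ σ = 𝟙 (cycleStep? i j L (suc t) σ)
  f₃ σ = 𝟙 (cycleStep? i j L t σ)
  per-σ : ∀ {σ} → σ ∈ Sym n →
    ∑[ c ∈ allFin (suc n) ] 𝟙 (cycleStep? (punchIn x i) (punchIn x j) (suc L) (suc t) (insert σ c))
      ≡ c₁ * f₁ σ + c₂ * f₂ σ + c₃ * f₃ σ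
  per-σ {σ} σ∈ with R , R-cycle ← cycleLength-exists σ (∈-Sym⁻ σ∈) i =
    InsertionIntoCycle.∑-insert-cycleStep-recurrence x (∈-Sym⁻ σ∈) R-cycle j t<L
  count≡∑ : ∀ L t → cycleStepCount n i j L t ≡ ∑[ σ ∈ Sym n ] 𝟙 (cycleStep? i j L t σ)
  count≡∑ L t = length-filter≡∑𝟙 (cycleStep? i j L t) (Sym n)

-- The count (n - 2)!

third-point : ∀ {m} {i j : Fin (3 + m)} → i ≢ j → ∃ λ x → x ≢ i × x ≢ j
third-point {i = i} {j} i≢j = punchIn i (punchIn j′ zero) , punchInᵢ≢i i _ , x≢j
  where
  j′ = punchOut i≢j
  x≢j : punchIn i (punchIn j′ zero) ≢ j
  x≢j eq = punchInᵢ≢i j′ zero (punchIn-injective i _ _ (trans eq (sym (punchIn-punchOut i≢j))))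

cycleStepCount-2 : {i j : Fin 2} → i ≢ j → cycleStepCount 2 i j 2 1 ≡ 1
cycleStepCount-2 {zero}     {zero}     0≢0 = ⊥-elim (0≢0 refl)
cycleStepCount-2 {zero}     {suc zero} _   = refl
cycleStepCount-2 {suc zero} {zero}     _   = refl
cycleStepCount-2 {suc zero} {suc zero} 1≢1 = ⊥-elim (1≢1 refl)

cycleStepCount[2+m]≡m! : ∀ m {i j : Fin (2 + m)} → i ≢ j → ∀ {L t} → t < L → L ≤ suc m →
                         cycleStepCount (2 + m) i j (suc L) (suc t) ≡ m !
cycleStepCount[2+m]≡m! zero    i≢j {suc zero} (s≤s z≤n) (s≤s z≤n) = cycleStepCount-2 i≢j
cycleStepCount[2+m]≡m! (suc m) {i} {j} i≢j {L} {t} t<L L≤2+m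
  with x , x≢i , x≢j ← third-point i≢j = begin
  cycleStepCount (3 + m) i j (suc L) (suc t)
    ≡⟨ cong₂ (λ i j → cycleStepCount (3 + m) i j (suc L) (suc t))
             (punchIn-punchOut x≢i) (punchIn-punchOut x≢j) ⟨
  cycleStepCount (3 + m) (punchIn x i′) (punchIn x j′) (suc L) (suc t)
    ≡⟨ cycleStepCount-suc x i′ j′ t<L ⟩
  (2 + m ∸ L) * N (suc L) (suc t) + (L ∸ suc t) * N L (suc t) + t * N L t
    ≡⟨ cong₂ _+_ (cong₂ _+_ (*-cong-or-zero (2 + m ∸ L) first) (*-cong-or-zero (L ∸ suc t) second))
                 (*-cong-or-zero t (third t t<L)) ⟩
  (2 + m ∸ L) * m ! + (L ∸ suc t) * m ! + t * m !
    ≡⟨ trans (*-distribʳ-+ (m !) (2 + m ∸ L + (L ∸ suc t)) t)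
             (cong (_+ t * m !) (*-distribʳ-+ (m !) (2 + m ∸ L) _)) ⟨
  ((2 + m ∸ L) + (L ∸ suc t) + t) * m !
    ≡⟨ cong (_* m !) (coefficients-sum t<L L≤2+m) ⟩
  suc m * m ! ∎
  where
  open ≡-Reasoning
  i′ = punchOut x≢i
  j′ = punchOut x≢j
  i′≢j′ : i′ ≢ j′
  i′≢j′ eq =
    i≢j (trans (sym (punchIn-punchOut x≢i)) (trans (cong (punchIn x) eq) (punchIn-punchOut x≢j)))
  N : ℕ → ℕ → ℕ
  N = cycleStepCount (2 + m) i′ j′
  IH : ∀ {L t} → t < L → L ≤ suc m → N (suc L) (suc t) ≡ m !
  IH = cycleStepCount[2+m]≡m! m i′≢j′
  IH-pred : ∀ {L t} → suc t < L → L ≤ 2 + m → N L (suc t) ≡ m !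
  IH-pred (s≤s t<L) (s≤s L≤1+m) = IH t<L L≤1+m
  first : 2 + m ∸ L ≡ 0 ⊎ N (suc L) (suc t) ≡ m !
  first with m≤n⇒m<n∨m≡n L≤2+m
  ... | inj₁ (s≤s L≤1+m) = inj₂ (IH t<L L≤1+m)
  ... | inj₂ refl        = inj₁ (n∸n≡0 (2 + m))
  second : L ∸ suc t ≡ 0 ⊎ N L (suc t) ≡ m !
  second with suc t <? L
  ... | no  1+t≮L = inj₁ (m≤n⇒m∸n≡0 (≮⇒≥ 1+t≮L))
  ... | yes 1+t<L = inj₂ (IH-pred 1+t<L L≤2+m)
  third : ∀ t → t < L → t ≡ 0 ⊎ N L t ≡ m !
  third zero     _   = inj₁ refl
  third (suc t′) t<L = inj₂ (IH-pred t<L L≤2+m)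

cycleStepCount≡[n∸2]! : ∀ {n} {i j : Fin n} → i ≢ j → ∀ {L t} → 1 ≤ t → t < L → L ≤ n →
                        cycleStepCount n i j L t ≡ (n ∸ 2) !
cycleStepCount≡[n∸2]! {suc zero} {zero} {zero} 0≢0 _ _ _ = ⊥-elim (0≢0 refl)
cycleStepCount≡[n∸2]! {suc (suc m)} i≢j {suc L} {suc t} _ (s≤s t<L) (s≤s L≤1+m) =
  cycleStepCount[2+m]≡m! m i≢j t<L L≤1+m

cycleStepCount-half : ∀ {n} {i j : Fin n} → i ≢ j → ∀ {ρ} → 1 ≤ ρ → 2 * ρ ≤ n →
                      cycleStepCount n i j (2 * ρ) ρ ≡ (n ∸ 2) !
cycleStepCount-half i≢j {ρ} 1≤ρ 2ρ≤n =
  cycleStepCount≡[n∸2]! i≢j 1≤ρ (m<m+n ρ (≤-trans 1≤ρ (m≤m+n ρ 0))) 2ρ≤n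

-- Odd divisors

module _ {n : ℕ} {π : Vec (Fin n) n} {i j : Fin n} where

  cycleStep⇒iter-swap : ∀ {ρ d} → CycleStep π i j (2 * ρ) ρ → d % 2 ≡ 1 →
                        iter π (ρ * d) i ≡ j × iter π (ρ * d) j ≡ i
  cycleStep⇒iter-swap {ρ} {d} (2ρ-cycle , πᵖi≡j) d%2≡1 = πᵏi≡j , πᵏj≡i
    where
    open ≡-Reasoning
    a : ℕ
    a = d / 2
    ρd≡ρ+a*2ρ : ρ * d ≡ ρ + a * (2 * ρ)
    ρd≡ρ+a*2ρ = begin
      ρ * d                ≡⟨ cong (ρ *_) (m≡m%n+[m/n]*n d 2) ⟩
      ρ * (d % 2 + a * 2)  ≡⟨ cong (λ r → ρ * (r + a * 2)) d%2≡1 ⟩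
      ρ * (1 + a * 2)      ≡⟨ rearrange ρ a ⟩
      ρ + a * (2 * ρ)      ∎
      where
      rearrange : ∀ ρ a → ρ * (1 + a * 2) ≡ ρ + a * (2 * ρ)
      rearrange = solve-∀
    πᵏi≡j : iter π (ρ * d) i ≡ j
    πᵏi≡j = begin
      iter π (ρ * d) i             ≡⟨ cong (λ s → iter π s i) ρd≡ρ+a*2ρ ⟩
      iter π (ρ + a * (2 * ρ)) i   ≡⟨ iter-+-*-cycleLength π 2ρ-cycle ρ a ⟩
      iter π ρ i                   ≡⟨ πᵖi≡j ⟩
      j                            ∎
    πᵏj≡i : iter π (ρ * d) j ≡ i
    πᵏj≡i = begin
      iter π (ρ * d) j             ≡⟨ cong (iter π (ρ * d)) πᵖi≡j ⟨
      iter π (ρ * d) (iter π ρ i)  ≡⟨ iter-+ π (ρ * d) ρ i ⟨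
      iter π (ρ * d + ρ) i         ≡⟨ cong (λ s → iter π (s + ρ) i) ρd≡ρ+a*2ρ ⟩
      iter π (ρ + a * (2 * ρ) + ρ) i ≡⟨ cong (λ s → iter π s i) (rearrange ρ a) ⟩
      iter π (suc a * (2 * ρ)) i   ≡⟨ iter-*-cycleLength π 2ρ-cycle (suc a) ⟩
      i                            ∎
      where
      rearrange : ∀ ρ a → ρ + a * (2 * ρ) + ρ ≡ suc a * (2 * ρ)
      rearrange = solve-∀

  iter-swap⇒cycleStep : IsPerm π → i ≢ j → ∀ k → iter π k i ≡ j → iter π k j ≡ i →
                        ∃ λ ρ → ∃ λ d → ρ * d ≡ k × d % 2 ≡ 1 × CycleStep π i j (2 * ρ) ρ
  iter-swap⇒cycleStep π-perm i≢j k πᵏi≡j πᵏj≡i with R , R-cycle ← cycleLength-exists π π-perm i =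
    ρ , 1 + q * 2 , ρ[1+2q]≡k , [m+kn]%n≡m%n 1 q 2 , subst (IsCycleLength π i) R≡2ρ R-cycle , πᵖi≡j
    where
    open ≡-Reasoning
    instance
      R-nonZero : NonZero R
      R-nonZero = >-nonZero (proj₁ R-cycle)
    ρ q : ℕ
    ρ = k % R
    q = k / R
    πᵖi≡j : iter π ρ i ≡ j
    πᵖi≡j = trans (iter-%-cycleLength π R-cycle k) πᵏi≡j
    1≤ρ : 1 ≤ ρ
    1≤ρ = n≢0⇒n>0 λ ρ≡0 → i≢j (trans (cong (λ s → iter π s i) (sym ρ≡0)) πᵖi≡j)
    k≡ρ+qR : k ≡ ρ + q * R
    k≡ρ+qR = m≡m%n+[m/n]*n k R
    R∣k+ρ : R ∣ k + ρ
    R∣k+ρ = cycleLength-∣ π R-cycle (trans (iter-+ π k ρ i) (trans (cong (iter π k) πᵖi≡j) πᵏj≡i))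
    R∣ρ+ρ : R ∣ ρ + ρ
    R∣ρ+ρ = ∣m+n∣m⇒∣n (subst (R ∣_) (trans (cong (_+ ρ) k≡ρ+qR) (rearrange ρ (q * R))) R∣k+ρ)
                      (n∣m*n q)
      where
      rearrange : ∀ ρ x → ρ + x + ρ ≡ x + (ρ + ρ)
      rearrange = solve-∀
    ρ+ρ≡R : ρ + ρ ≡ R
    ρ+ρ≡R = m∣n∧0<n<m+m⇒n≡m R∣ρ+ρ (≤-trans 1≤ρ (m≤m+n ρ ρ)) (+-mono-< (m%n<n k R) (m%n<n k R))
    R≡2ρ : R ≡ 2 * ρ
    R≡2ρ = trans (sym ρ+ρ≡R) (cong (ρ +_) (sym (+-identityʳ ρ)))
    ρ[1+2q]≡k : ρ * (1 + q * 2) ≡ k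
    ρ[1+2q]≡k = begin
      ρ * (1 + q * 2)    ≡⟨ rearrange ρ q ⟩
      ρ + q * (ρ + ρ)    ≡⟨ cong (λ r → ρ + q * r) ρ+ρ≡R ⟩
      ρ + q * R          ≡⟨ k≡ρ+qR ⟨
      k                  ∎
      where
      rearrange : ∀ ρ q → ρ * (1 + q * 2) ≡ ρ + q * (ρ + ρ)
      rearrange = solve-∀

module OddDivisorDecomposition {k : ℕ} (1≤k : 1 ≤ k) where

  oddDivisors : List ℕ
  oddDivisors = filter (oddDivisor? k) (map suc (upTo k))

  oddDivisors-Unique : Unique oddDivisors
  oddDivisors-Unique = Unique.filter⁺ (oddDivisor? k) (Unique.map⁺ suc-injective (Unique.upTo⁺ k))

  ∈-oddDivisors⁺ : ∀ {d} → d ∣ k → d % 2 ≡ 1 → d ∈ oddDivisors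
  ∈-oddDivisors⁺ {suc d} d∣k d%2≡1 =
    ∈-filter⁺ (oddDivisor? k) (∈-map⁺ suc (∈-upTo⁺ (∣⇒≤ {{>-nonZero 1≤k}} d∣k))) (d∣k , d%2≡1)

  ∈-oddDivisors⁻ : ∀ {d} → d ∈ oddDivisors → OddDivisor k d
  ∈-oddDivisors⁻ d∈ = proj₂ (∈-filter⁻ (oddDivisor? k) {xs = map suc (upTo k)} d∈)

  -- k / d, with the junk value 0 at d = 0, which is not an odd divisor.
  cofactor : ℕ → ℕ
  cofactor zero      = 0
  cofactor d@(suc _) = k / d

  cofactor-* : ∀ {d} → d ∣ k → d % 2 ≡ 1 → cofactor d * d ≡ k
  cofactor-* {suc d} d∣k _ = m/n*n≡m d∣k

  1≤cofactor : ∀ {d} → d ∣ k → d % 2 ≡ 1 → 1 ≤ cofactor d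
  1≤cofactor d∣k d%2≡1 =
    n≢0⇒n>0 λ c≡0 → <⇒≢ 1≤k (sym (trans (sym (cofactor-* d∣k d%2≡1)) (cong (_* _) c≡0)))

  cofactor-unique : ∀ {ρ d} → ρ * d ≡ k → d % 2 ≡ 1 → cofactor d ≡ ρ
  cofactor-unique {ρ} {suc d} ρd≡k _ = trans (cong (_/ suc d) (sym ρd≡k)) (m*n/n≡m ρ (suc d))

  cofactor≤k : ∀ d → cofactor d ≤ k
  cofactor≤k zero      = z≤n
  cofactor≤k d@(suc _) = m/n≤m k d

  module _ {n : ℕ} {i j : Fin n} where

    swap? : (π : Vec (Fin n) n) → Dec (iter π k i ≡ j × iter π k j ≡ i)
    swap? π = (iter π k i ≟ j) ×-dec (iter π k j ≟ i)

    halfCycleStep? : ∀ d (π : Vec (Fin n) n) → Dec (CycleStep π i j (2 * cofactor d) (cofactor d))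
    halfCycleStep? d = cycleStep? i j (2 * cofactor d) (cofactor d)

    ¬swap⇒∑-halfCycleStep≡0 : ∀ {π} → ¬ (iter π k i ≡ j × iter π k j ≡ i) →
                              ∑[ d ∈ oddDivisors ] 𝟙 (halfCycleStep? d π) ≡ 0
    ¬swap⇒∑-halfCycleStep≡0 {π} ¬swap =
      ∑-zero oddDivisors λ {d} d∈ → 𝟙-no (halfCycleStep? d π) λ step → ¬swap (swaps d∈ step)
      where
      swaps : ∀ {d} → d ∈ oddDivisors → CycleStep π i j (2 * cofactor d) (cofactor d) →
              iter π k i ≡ j × iter π k j ≡ i
      swaps {d} d∈ step with d∣k , d%2≡1 ← ∈-oddDivisors⁻ d∈ =
        subst (λ m → iter π m i ≡ j × iter π m j ≡ i) (cofactor-* d∣k d%2≡1)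
              (cycleStep⇒iter-swap {ρ = cofactor d} {d = d} step d%2≡1)

    cycleStep⇒∑-halfCycleStep≡1 : ∀ {π ρ d} → ρ * d ≡ k → d % 2 ≡ 1 → CycleStep π i j (2 * ρ) ρ →
                                  ∑[ d ∈ oddDivisors ] 𝟙 (halfCycleStep? d π) ≡ 1
    cycleStep⇒∑-halfCycleStep≡1 {π} {ρ} {d} ρd≡k d%2≡1 step =
      ∑-𝟙-unique (λ d → halfCycleStep? d π) oddDivisors-Unique d∈ d-step unique
      where
      d∣k : d ∣ k
      d∣k = divides ρ (sym ρd≡k)
      d∈ : d ∈ oddDivisors
      d∈ = ∈-oddDivisors⁺ d∣k d%2≡1
      cofactor[d]≡ρ : cofactor d ≡ ρ
      cofactor[d]≡ρ = cofactor-unique ρd≡k d%2≡1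
      d-step : CycleStep π i j (2 * cofactor d) (cofactor d)
      d-step = subst (λ r → CycleStep π i j (2 * r) r) (sym cofactor[d]≡ρ) step
      unique : ∀ {d′} → d′ ∈ oddDivisors → CycleStep π i j (2 * cofactor d′) (cofactor d′) → d′ ≡ d
      unique {d′} d′∈ d′-step = *-cancelˡ-≡ d′ d ρ {{>-nonZero 1≤ρ}} (begin
        ρ * d′             ≡⟨ cong (_* d′) cofactor[d′]≡ρ ⟨
        cofactor d′ * d′   ≡⟨ cofactor-* d′∣k d′%2≡1 ⟩
        k                  ≡⟨ ρd≡k ⟨
        ρ * d              ∎)
        where
        open ≡-Reasoning
        d′∣k : d′ ∣ k
        d′∣k = proj₁ (∈-oddDivisors⁻ d′∈)
        d′%2≡1 : d′ % 2 ≡ 1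
        d′%2≡1 = proj₂ (∈-oddDivisors⁻ d′∈)
        cofactor[d′]≡ρ : cofactor d′ ≡ ρ
        cofactor[d′]≡ρ =
          *-cancelˡ-≡ (cofactor d′) ρ 2 (leastPositive-unique (proj₁ d′-step) (proj₁ step))
        1≤ρ : 1 ≤ ρ
        1≤ρ = subst (1 ≤_) cofactor[d]≡ρ (1≤cofactor d∣k d%2≡1)

    𝟙-swap≡∑-halfCycleStep : i ≢ j → ∀ {π} → IsPerm π →
                             𝟙 (swap? π) ≡ ∑[ d ∈ oddDivisors ] 𝟙 (halfCycleStep? d π)
    𝟙-swap≡∑-halfCycleStep i≢j {π} π-perm with swap? π
    ... | no ¬swap = sym (¬swap⇒∑-halfCycleStep≡0 ¬swap)
    ... | yes (πᵏi≡j , πᵏj≡i) =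
      let ρ , d , ρd≡k , d%2≡1 , step = iter-swap⇒cycleStep π-perm i≢j k πᵏi≡j πᵏj≡i in
      sym (cycleStep⇒∑-halfCycleStep≡1 {π} {ρ} {d} ρd≡k d%2≡1 step)

    halfCycleStepCount : i ≢ j → 2 * k ≤ n → ∀ {d} → d ∈ oddDivisors →
                         ∑[ π ∈ Sym n ] 𝟙 (halfCycleStep? d π) ≡ (n ∸ 2) !
    halfCycleStepCount i≢j 2k≤n {d} d∈ = begin
      ∑[ π ∈ Sym n ] 𝟙 (halfCycleStep? d π)
        ≡⟨ length-filter≡∑𝟙 (halfCycleStep? d) (Sym n) ⟨
      cycleStepCount n i j (2 * cofactor d) (cofactor d)
        ≡⟨ cycleStepCount-half i≢j (1≤cofactor d∣k d%2≡1) 2c≤n ⟩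
      (n ∸ 2) ! ∎
      where
      open ≡-Reasoning
      d∣k : d ∣ k
      d∣k = proj₁ (∈-oddDivisors⁻ d∈)
      d%2≡1 : d % 2 ≡ 1
      d%2≡1 = proj₂ (∈-oddDivisors⁻ d∈)
      2c≤n : 2 * cofactor d ≤ n
      2c≤n = ≤-trans (*-monoʳ-≤ 2 (cofactor≤k d)) 2k≤n

lemma2p6 : (k n : ℕ) → 1 ≤ k → n ≥ 2 * k + 1 → (i j : Fin n) → i ≢ j →
    countSwap n k i j ≡ τₒ k * (n ∸ 2) !
lemma2p6 k n 1≤k n≥2k+1 i j i≢j = begin
  countSwap n k i j
    ≡⟨ length-filter≡∑𝟙 swap? (Sym n) ⟩
  ∑[ π ∈ Sym n ] 𝟙 (swap? π)
    ≡⟨ ∑-cong (Sym n) (𝟙-swap≡∑-halfCycleStep i≢j ∘ ∈-Sym⁻) ⟩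
  ∑[ π ∈ Sym n ] ∑[ d ∈ oddDivisors ] 𝟙 (halfCycleStep? d π)
    ≡⟨ ∑-comm (Sym n) oddDivisors _ ⟩
  ∑[ d ∈ oddDivisors ] ∑[ π ∈ Sym n ] 𝟙 (halfCycleStep? d π)
    ≡⟨ ∑-cong oddDivisors (halfCycleStepCount i≢j 2k≤n) ⟩
  ∑[ d ∈ oddDivisors ] ((n ∸ 2) !)
    ≡⟨ ∑-const oddDivisors ((n ∸ 2) !) ⟩
  τₒ k * (n ∸ 2) ! ∎
  where
  open ≡-Reasoning
  open OddDivisorDecomposition 1≤k
  2k≤n : 2 * k ≤ n
  2k≤n = ≤-trans (m≤m+n (2 * k) 1) n≥2k+1
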